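{- Let $S$ be an $\aleph_0$-categorical semigroup. Then every principal factor of $S$ is $\aleph_0$-categorical, and each principal factor of $S$ is either completely $0$-simple, completely simple, or null. Moreover, $S$ has only finitely many principal factors up to isomorphism.
   Context: All semigroups are countable (finite or countably infinite). For a semigroup $S$ and $n\ge 1$, $\operatorname{Aut}(S)$ acts on $S^n$ coordinatewise. A countable semigroup $S$ is $\aleph_0$-categorical if for every $n\geq 1$ this action of $\operatorname{Aut}(S)$ on $S^n$ has only finitely many orbits (by the Ryll-Nardzewski theorem this is equivalent to $S$ being determined up to isomorphism among countable structures by its first-order theory). For $a\in S$ let $J(a)=S^1aS^1$ be the principal two-sided ideal generated by $a$, $J_a$ the $\mathcal{J}$-class of $a$, and $I(a)=J(a)\setminus J_a$. The principal factors of $S$ are the Rees quotients $J(a)/I(a)$ for those $a$ with $I(a)\neq\emptyset$, together with the kernel (minimum ideal) of $S$ if it exists. A semigroup with zero is null if all products equal $0$. -}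

module Defs where

open import Level using (0ℓ) renaming (suc to lsuc)
open import Algebra.Bundles using (Semigroup)
open import Algebra.Structures using (IsSemigroup; IsMagma)
open import Relation.Binary.Structures using (IsEquivalence)
open import Data.Nat using (ℕ)
open import Data.Fin using (Fin)
open import Data.Maybe using (Maybe; just; nothing)
open import Data.List using (List)
open import Data.List.Relation.Unary.Any using (Any)
open import Data.Product using (Σ; ∃; ∃-syntax; _×_; _,_; proj₁; proj₂)
open import Data.Sum using (_⊎_; inj₁; inj₂)
open import Relation.Nullary using (¬_)

module _ (S : Semigroup 0ℓ 0ℓ) where
  open Semigroup S

  -- countable: (classically) image of a subset of ℕ; covers finite,
  -- countably infinite and empty carriers
  Countable : Set₁
  Countable = Σ (ℕ → Set) λ P → Σ (Σ ℕ P → Carrier) λ f →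
                ∀ y → ∃ λ x → f x ≈ y

  record Automorphism : Set where
    field
      fun       : Carrier → Carrier
      cong      : ∀ {x y} → x ≈ y → fun x ≈ fun y
      homo      : ∀ x y → fun (x ∙ y) ≈ fun x ∙ fun y
      injective : ∀ {x y} → fun x ≈ fun y → x ≈ y
      surjective : ∀ y → ∃ λ x → fun x ≈ y

  SameOrbit : ∀ {n} → (Fin n → Carrier) → (Fin n → Carrier) → Set
  SameOrbit u v = ∃ λ (f : Automorphism) → ∀ i → Automorphism.fun f (u i) ≈ v i

  FinitelyManyOrbits : ℕ → Set
  FinitelyManyOrbits n =
    ∃ λ (reps : List (Fin n → Carrier)) → ∀ u → Any (λ r → SameOrbit r u) reps

  -- ℵ₀-categorical (via Ryll-Nardzewski, as in the paper's definition)
  Aleph0Categorical : Set₁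
  Aleph0Categorical = Countable × (∀ n → 1 Data.Nat.≤ n → FinitelyManyOrbits n)

  IsZero : Carrier → Set
  IsZero z = ∀ x → (z ∙ x ≈ z) × (x ∙ z ≈ z)

  IsNull : Set
  IsNull = ∃ λ z → IsZero z × (∀ x y → x ∙ y ≈ z)

  IsIdeal : (Carrier → Set) → Set
  IsIdeal P = (∀ {x y} → x ≈ y → P x → P y)
            × (∃ λ x → P x)
            × (∀ s x → P x → P (s ∙ x))
            × (∀ x s → P x → P (x ∙ s))

  IsIdempotent : Carrier → Set
  IsIdempotent e = e ∙ e ≈ e

  _≤E_ : Carrier → Carrier → Set
  f ≤E e = (f ≈ e ∙ f) × (f ≈ f ∙ e)

  IsPrimitive : Carrier → Set
  IsPrimitive e = IsIdempotent e × (∀ f → IsIdempotent f → f ≤E e → f ≈ e)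

  IsPrimitive₀ : Carrier → Carrier → Set
  IsPrimitive₀ z e = IsIdempotent e × ¬ (e ≈ z)
                   × (∀ f → IsIdempotent f → ¬ (f ≈ z) → f ≤E e → f ≈ e)

  IsSimple : Set₁
  IsSimple = ∀ P → IsIdeal P → ∀ x → P x

  IsCompletelySimple : Set₁
  IsCompletelySimple = IsSimple × ∃ IsPrimitive

  Is0Simple : Carrier → Set₁
  Is0Simple z = IsZero z
              × (∃ λ x → ∃ λ y → ¬ (x ∙ y ≈ z))
              × (∀ P → IsIdeal P → (∀ x → P x → x ≈ z) ⊎ (∀ x → P x))

  IsCompletely0Simple : Set₁
  IsCompletely0Simple = ∃ λ z → Is0Simple z × ∃ (IsPrimitive₀ z)

  IsKernel : (Carrier → Set) → Set₁
  IsKernel K = IsIdeal K × (∀ Q → IsIdeal Q → ∀ x → K x → Q x)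

record _≅_ (S T : Semigroup 0ℓ 0ℓ) : Set where
  private
    module S = Semigroup S
    module T = Semigroup T
  field
    fun        : S.Carrier → T.Carrier
    cong       : ∀ {x y} → x S.≈ y → fun x T.≈ fun y
    homo       : ∀ x y → fun (x S.∙ y) T.≈ fun x T.∙ fun y
    injective  : ∀ {x y} → fun x T.≈ fun y → x S.≈ y
    surjective : ∀ y → ∃ λ x → fun x T.≈ y

module Principal (S : Semigroup 0ℓ 0ℓ) where
  open Semigroup S

  -- multiplication by elements of S¹ (nothing = adjoined identity)
  _·ˡ_ : Maybe Carrier → Carrier → Carrier
  nothing ·ˡ x = x
  just s  ·ˡ x = s ∙ x

  _·ʳ_ : Carrier → Maybe Carrier → Carrier
  x ·ʳ nothing = x
  x ·ʳ just t  = x ∙ t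

  -- x ∈ J(a) = S¹ a S¹
  J : Carrier → Carrier → Set
  J a x = ∃ λ s → ∃ λ t → x ≈ (s ·ˡ a) ·ʳ t

  Jclass : Carrier → Carrier → Set
  Jclass a x = J a x × J x a

  I : Carrier → Carrier → Set
  I a x = J a x × ¬ (J x a)

  private
    ·ˡ-cong : ∀ s {x y} → x ≈ y → s ·ˡ x ≈ s ·ˡ y
    ·ˡ-cong nothing p = p
    ·ˡ-cong (just s) p = ∙-congˡ p

    ·ʳ-cong : ∀ t {x y} → x ≈ y → x ·ʳ t ≈ y ·ʳ t
    ·ʳ-cong nothing p = p
    ·ʳ-cong (just t) p = ∙-congʳ p

    mixed : ∀ s x t → s ·ˡ (x ·ʳ t) ≈ (s ·ˡ x) ·ʳ t
    mixed nothing x t = refl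
    mixed (just s) x nothing = refl
    mixed (just s) x (just t) = sym (assoc s x t)

    _⊙_ : Maybe Carrier → Maybe Carrier → Maybe Carrier
    nothing ⊙ t = t
    just s ⊙ nothing = just s
    just s ⊙ just t = just (s ∙ t)

    ·ˡ-⊙ : ∀ s t x → s ·ˡ (t ·ˡ x) ≈ (s ⊙ t) ·ˡ x
    ·ˡ-⊙ nothing t x = refl
    ·ˡ-⊙ (just s) nothing x = refl
    ·ˡ-⊙ (just s) (just t) x = sym (assoc s t x)

    ·ʳ-⊙ : ∀ x s t → (x ·ʳ s) ·ʳ t ≈ x ·ʳ (s ⊙ t)
    ·ʳ-⊙ x nothing t = refl
    ·ʳ-⊙ x (just s) nothing = refl
    ·ʳ-⊙ x (just s) (just t) = assoc x s t

  J-resp : ∀ a {x y} → x ≈ y → J a x → J a y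
  J-resp a p (s , t , q) = s , t , trans (sym p) q

  J-trans : ∀ {a b x} → J a b → J b x → J a x
  J-trans {a} {b} {x} (s , t , p) (u , v , q) =
    (u ⊙ s) , (t ⊙ v) ,
    trans q (trans (·ʳ-cong v (·ˡ-cong u p))
      (trans (·ʳ-cong v (mixed u (s ·ˡ a) t))
      (trans (·ʳ-⊙ (u ·ˡ (s ·ˡ a)) t v)
      (·ʳ-cong (t ⊙ v) (·ˡ-⊙ u s a)))))

  J-refl : ∀ a → J a a
  J-refl a = nothing , nothing , refl

  J-left : ∀ s x → J x (s ∙ x)
  J-left s x = just s , nothing , refl

  J-right : ∀ x t → J x (x ∙ t)
  J-right x t = nothing , just t , refl

  J-resp-base : ∀ {a b} x → a ≈ b → J a x → J b x
  J-resp-base x p q = J-trans (nothing , nothing , p) q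

  I-resp : ∀ a {x y} → x ≈ y → I a x → I a y
  I-resp a p (j , n) = J-resp a p j , λ k → n (J-resp-base a (sym p) k)

  I-left : ∀ a s x → I a x → I a (s ∙ x)
  I-left a s x (j , n) = J-trans j (J-left s x) , λ k → n (J-trans (J-left s x) k)

  I-right : ∀ a x t → I a x → I a (x ∙ t)
  I-right a x t (j , n) = J-trans j (J-right x t) , λ k → n (J-trans (J-right x t) k)

  -- The Rees factor J(a)/I(a): carrier J(a), with all of I(a) identified
  -- (to the zero) via the Rees congruence.
  module Rees (a : Carrier) where
    Car : Set
    Car = Σ Carrier (J a)

    _≈R_ : Car → Car → Set
    (x , _) ≈R (y , _) = x ≈ y ⊎ (I a x × I a y)

    _∙R_ : Car → Car → Car
    (x , p) ∙R (y , q) = x ∙ y , J-trans p (J-right x y)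

    isEq : IsEquivalence _≈R_
    isEq = record
      { refl  = inj₁ refl
      ; sym   = λ { (inj₁ p) → inj₁ (sym p) ; (inj₂ (i , j)) → inj₂ (j , i) }
      ; trans = λ { (inj₁ p) (inj₁ q) → inj₁ (trans p q)
                  ; (inj₁ p) (inj₂ (i , j)) → inj₂ (I-resp a (sym p) i , j)
                  ; (inj₂ (i , j)) (inj₁ q) → inj₂ (i , I-resp a q j)
                  ; (inj₂ (i , _)) (inj₂ (_ , k)) → inj₂ (i , k) } }

    congR : ∀ {x x' y y'} → x ≈R x' → y ≈R y' → (x ∙R y) ≈R (x' ∙R y')
    congR {x , _} {x' , _} {y , _} {y' , _} (inj₁ p) (inj₁ q) = inj₁ (∙-cong p q)
    congR {x , _} {x' , _} {y , _} {y' , _} _ (inj₂ (i , j)) =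
      inj₂ (I-left a x y i , I-left a x' y' j)
    congR {x , _} {x' , _} {y , _} {y' , _} (inj₂ (i , j)) (inj₁ _) =
      inj₂ (I-right a x y i , I-right a x' y' j)

    semigroup : Semigroup 0ℓ 0ℓ
    semigroup = record
      { Carrier = Car
      ; _≈_ = _≈R_
      ; _∙_ = _∙R_
      ; isSemigroup = record
        { isMagma = record { isEquivalence = isEq ; ∙-cong = λ {x} {x'} {y} {y'} → congR {x} {x'} {y} {y'} }
        ; assoc = λ x y z → inj₁ (assoc (proj₁ x) (proj₁ y) (proj₁ z)) } }

  module Sub (K : Carrier → Set) (idl : IsIdeal S K) where
    semigroup : Semigroup 0ℓ 0ℓ
    semigroup = record
      { Carrier = Σ Carrier K
      ; _≈_ = λ x y → proj₁ x ≈ proj₁ y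
      ; _∙_ = λ x y → proj₁ x ∙ proj₁ y , proj₂ (proj₂ (proj₂ idl)) (proj₁ x) (proj₁ y) (proj₂ x)
      ; isSemigroup = record
        { isMagma = record
          { isEquivalence = record { refl = refl ; sym = sym ; trans = trans }
          ; ∙-cong = ∙-cong }
        ; assoc = λ x y z → assoc (proj₁ x) (proj₁ y) (proj₁ z) } }

  -- Index type of the principal factors of S:
  --  * J(a)/I(a) for each a with I(a) ≠ ∅, and
  --  * the kernel K (minimum ideal), if it exists.
  PrincipalFactorIndex : Set₁
  PrincipalFactorIndex =
    (Σ Carrier λ a → ∃ λ x → I a x) ⊎ (Σ (Carrier → Set) (IsKernel S))

  principalFactor : PrincipalFactorIndex → Semigroup 0ℓ 0ℓ
  principalFactor (inj₁ (a , _)) = Rees.semigroup a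
  principalFactor (inj₂ (K , ker)) = Sub.semigroup K (proj₁ ker)

module Submission where

-- Two of the pairs (x, xᵏ⁺¹) share an Aut(S)-orbit, so S is periodic.  In a
-- periodic semigroup comparable 𝒥-related idempotents are equal
-- (`comparable-J-idempotents`).  If some product of elements of J_a lies in
-- J_a, then a = LaR with L, R ∈ J(a) (`self-divisible`): an idempotent power
-- of R is then a primitive nonzero idempotent and J(a)/I(a) is completely
-- 0-simple; otherwise it is null.  The kernel is simple with primitive
-- idempotents.  Automorphisms restrict to the kernel and induce isomorphisms
-- J(a)/I(a) ≅ J(ha)/I(ha); so orbits of n-tuples in a factor come from orbits
-- of (n+1)-tuples in S (`orbits-transfer`), and one factor per orbit of
-- elements, plus the kernel, represents all principal factors.  Excluded
-- middle decides membership in I(a) and the existence of nonzero products.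

open import Defs
open import Level using (0ℓ; lift; lower) renaming (suc to lsuc)
open import Algebra.Bundles using (Semigroup; Monoid)
open import Axiom.ExcludedMiddle using (ExcludedMiddle)
open import Data.Empty using (⊥-elim)
open import Data.Fin using (Fin; toℕ)
import Data.Fin.Properties as FinP
open import Data.List using (List; []; _∷_; _++_; length; lookup; mapMaybe)
open import Data.List.Relation.Unary.Any as Any using (Any; index)
import Data.List.Relation.Unary.Any.Properties as Any
open import Data.Maybe using (Maybe; just; nothing)
import Data.Maybe.Relation.Binary.Pointwise as Pointwise
import Data.Maybe.Relation.Unary.Any as MaybeAny
open import Data.Nat using (ℕ; zero; suc; _+_; _*_; _∸_; _<_; _≤_; s≤s; z≤n)
import Data.Nat.Properties as ℕ
open import Data.Nat.Tactic.RingSolver using (solve-∀)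
open import Data.Product using (Σ; ∃; ∃₂; _×_; _,_; proj₁; proj₂)
open import Data.Sum using (_⊎_; inj₁; inj₂)
open import Relation.Binary.PropositionalEquality as ≡ using (_≡_)
open import Relation.Nullary using (¬_; Dec; yes; no)
open import Relation.Nullary.Decidable using (map′; decidable-stable)
open import Tactic.MonoidSolver using (solve)

module Classical (em : ExcludedMiddle (lsuc 0ℓ)) where

  decide : (A : Set) → Dec A
  decide A = map′ lower lift em

  decide₁ : (A : Set₁) → Dec A
  decide₁ A = em

  stable : {A : Set} → ¬ ¬ A → A
  stable {A} = decidable-stable (decide A)

mapMaybe-cover : ∀ {a b p q} {A : Set a} {B : Set b} {P : A → Set p} {Q : B → Set q}
                 (f : A → Maybe B) → (∀ {x} → P x → MaybeAny.Any Q (f x)) →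
                 ∀ {xs} → Any P xs → Any Q (mapMaybe f xs)
mapMaybe-cover f P⇒Q {xs} p = Any.mapMaybe⁺ f xs (Any.gmap P⇒Q p)

module IdealLaws (S : Semigroup 0ℓ 0ℓ) {P : Semigroup.Carrier S → Set}
                 (P-ideal : IsIdeal S P) where
  open Semigroup S

  resp : ∀ {x y} → x ≈ y → P x → P y
  resp = proj₁ P-ideal

  inhabited : ∃ P
  inhabited = proj₁ (proj₂ P-ideal)

  closedˡ : ∀ s x → P x → P (s ∙ x)
  closedˡ = proj₁ (proj₂ (proj₂ P-ideal))

  closedʳ : ∀ x s → P x → P (x ∙ s)
  closedʳ = proj₂ (proj₂ (proj₂ P-ideal))

-- The monoid S¹ obtained by adjoining an identity (`nothing`) to S.
-- Membership in J(a) = S¹aS¹ is divisibility in S¹, where the monoid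
-- solver takes care of rebracketing.
module UnitMonoid (S : Semigroup 0ℓ 0ℓ) where
  open Semigroup S
  open Principal S using (J; _·ˡ_; _·ʳ_)

  infixl 7 _⊙_
  _⊙_ : Maybe Carrier → Maybe Carrier → Maybe Carrier
  nothing ⊙ t       = t
  just s  ⊙ nothing = just s
  just s  ⊙ just t  = just (s ∙ t)

  infix 4 _≈¹_
  _≈¹_ : Maybe Carrier → Maybe Carrier → Set
  _≈¹_ = Pointwise.Pointwise _≈_

  S¹ : Monoid 0ℓ 0ℓ
  S¹ = record
    { Carrier  = Maybe Carrier
    ; _≈_      = _≈¹_
    ; _∙_      = _⊙_
    ; ε        = nothing
    ; isMonoid = record
      { isSemigroup = record
        { isMagma = record
          { isEquivalence = Pointwise.isEquivalence isEquivalence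
          ; ∙-cong        = ⊙-cong
          }
        ; assoc = ⊙-assoc
        }
      ; identity = (λ _ → Pointwise.refl refl) , ⊙-identityʳ
      }
    }
    where
      ⊙-cong : ∀ {x x′ y y′} → x ≈¹ x′ → y ≈¹ y′ → x ⊙ y ≈¹ x′ ⊙ y′
      ⊙-cong Pointwise.nothing  q                  = q
      ⊙-cong (Pointwise.just p) Pointwise.nothing  = Pointwise.just p
      ⊙-cong (Pointwise.just p) (Pointwise.just q) = Pointwise.just (∙-cong p q)

      ⊙-assoc : ∀ x y z → (x ⊙ y) ⊙ z ≈¹ x ⊙ (y ⊙ z)
      ⊙-assoc nothing  y        z        = Pointwise.refl refl
      ⊙-assoc (just x) nothing  z        = Pointwise.refl refl
      ⊙-assoc (just x) (just y) nothing  = Pointwise.refl refl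
      ⊙-assoc (just x) (just y) (just z) = Pointwise.just (assoc x y z)

      ⊙-identityʳ : ∀ x → x ⊙ nothing ≈¹ x
      ⊙-identityʳ nothing  = Pointwise.nothing
      ⊙-identityʳ (just x) = Pointwise.just refl

  sandwich : ∀ s a t → (s ⊙ just a) ⊙ t ≡ just ((s ·ˡ a) ·ʳ t)
  sandwich nothing  a nothing  = ≡.refl
  sandwich nothing  a (just t) = ≡.refl
  sandwich (just s) a nothing  = ≡.refl
  sandwich (just s) a (just t) = ≡.refl

  J⇒divides : ∀ {a x} → J a x → ∃₂ λ s t → just x ≈¹ (s ⊙ just a) ⊙ t
  J⇒divides {a} (s , t , x≈sat) =
    s , t , ≡.subst (just _ ≈¹_) (≡.sym (sandwich s a t)) (Pointwise.just x≈sat)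

module Factorisation (S : Semigroup 0ℓ 0ℓ) where
  open Semigroup S using (Carrier; _≈_; _∙_)
  open Principal S
  open UnitMonoid S
  open Monoid S¹ using (refl; trans; ∙-cong; setoid)
  open import Relation.Binary.Reasoning.Setoid setoid

  -- If x, y ∈ J(a) and a ∈ J(xy), then a = LaR with L ∈ J(x) and R ∈ J(y):
  -- write a = p(xy)q, y = u′av′, x = uav and substitute twice.
  self-divisible : ∀ {a x y} → J a x → J a y → J (x ∙ y) a →
                   ∃₂ λ L R → J x L × J y R × a ≈ (L ∙ a) ∙ R
  self-divisible {a} {x} {y} x∈J y∈J a∈J
    with J⇒divides a∈J | J⇒divides x∈J | J⇒divides y∈J
  ... | p , q , a≈pxyq | u , v , x≈uav | u′ , v′ , y≈u′av′ =
    (p ·ˡ x) ·ʳ ℓ , (v ·ˡ y) ·ʳ r , (p , ℓ , Semigroup.refl S) , (v , r , Semigroup.refl S) ,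
    Pointwise.drop-just a≈LaR
    where
      ℓ r : Maybe Carrier
      ℓ = u′ ⊙ (p ⊙ u)
      r = q ⊙ (v′ ⊙ q)

      a≈p[uav]yq : just a ≈¹ (p ⊙ (((u ⊙ just a) ⊙ v) ⊙ just y)) ⊙ q
      a≈p[uav]yq = trans a≈pxyq (∙-cong (∙-cong (refl {p}) (∙-cong x≈uav (refl {just y}))) (refl {q}))

      a≈LaR : just a ≈¹ just (((p ·ˡ x) ·ʳ ℓ ∙ a) ∙ (v ·ˡ y) ·ʳ r)
      a≈LaR = begin
        just a
          ≈⟨ a≈pxyq ⟩
        (p ⊙ (just x ⊙ just y)) ⊙ q
          ≈⟨ ∙-cong (∙-cong (refl {p}) (∙-cong (refl {just x}) y≈u′av′)) (refl {q}) ⟩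
        (p ⊙ (just x ⊙ ((u′ ⊙ just a) ⊙ v′))) ⊙ q
          ≈⟨ solve S¹ ⟩
        (((p ⊙ just x) ⊙ u′) ⊙ just a) ⊙ (v′ ⊙ q)
          ≈⟨ ∙-cong (∙-cong (refl {(p ⊙ just x) ⊙ u′}) a≈p[uav]yq) (refl {v′ ⊙ q}) ⟩
        (((p ⊙ just x) ⊙ u′) ⊙ ((p ⊙ (((u ⊙ just a) ⊙ v) ⊙ just y)) ⊙ q)) ⊙ (v′ ⊙ q)
          ≈⟨ solve S¹ ⟩
        (((p ⊙ just x) ⊙ ℓ) ⊙ just a) ⊙ ((v ⊙ just y) ⊙ r)
          ≡⟨ ≡.cong₂ (λ L R → (L ⊙ just a) ⊙ R) (sandwich p x ℓ) (sandwich v y r) ⟩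
        just (((p ·ˡ x) ·ʳ ℓ ∙ a) ∙ (v ·ˡ y) ·ʳ r)
          ∎

  factor-through : ∀ {a b c L R} → a ≈ (L ∙ a) ∙ R → J b a → J a c →
                   ∃₂ λ X Y → J L X × J R Y × c ≈ (X ∙ b) ∙ Y
  factor-through {a} {b} {c} {L} {R} a≈LaR a∈Jb c∈Ja
    with J⇒divides a∈Jb | J⇒divides c∈Ja
  ... | s′ , t′ , a≈s′bt′ | s , t , c≈sat =
    (s ·ˡ L) ·ʳ s′ , (t′ ·ˡ R) ·ʳ t , (s , s′ , Semigroup.refl S) , (t′ , t , Semigroup.refl S) ,
    Pointwise.drop-just c≈XbY
    where
      a≈Ls′bt′R : just a ≈¹ (just L ⊙ ((s′ ⊙ just b) ⊙ t′)) ⊙ just R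
      a≈Ls′bt′R = trans (Pointwise.just a≈LaR)
                        (∙-cong (∙-cong (refl {just L}) a≈s′bt′) (refl {just R}))

      c≈XbY : just c ≈¹ just (((s ·ˡ L) ·ʳ s′ ∙ b) ∙ (t′ ·ˡ R) ·ʳ t)
      c≈XbY = begin
        just c
          ≈⟨ c≈sat ⟩
        (s ⊙ just a) ⊙ t
          ≈⟨ ∙-cong (∙-cong (refl {s}) a≈Ls′bt′R) (refl {t}) ⟩
        (s ⊙ ((just L ⊙ ((s′ ⊙ just b) ⊙ t′)) ⊙ just R)) ⊙ t
          ≈⟨ solve S¹ ⟩
        (((s ⊙ just L) ⊙ s′) ⊙ just b) ⊙ ((t′ ⊙ just R) ⊙ t)
          ≡⟨ ≡.cong₂ (λ X Y → (X ⊙ just b) ⊙ Y) (sandwich s L s′) (sandwich t′ R t) ⟩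
        just (((s ·ˡ L) ·ʳ s′ ∙ b) ∙ (t′ ·ˡ R) ·ʳ t)
          ∎

module Powers (S : Semigroup 0ℓ 0ℓ) where
  open Semigroup S
  open Principal S using (J; J-refl; J-trans; J-left)
  open import Relation.Binary.Reasoning.Setoid setoid

  -- pow x n = xⁿ⁺¹
  pow : Carrier → ℕ → Carrier
  pow x zero    = x
  pow x (suc n) = x ∙ pow x n

  pow-cong : ∀ {x y} n → x ≈ y → pow x n ≈ pow y n
  pow-cong zero    x≈y = x≈y
  pow-cong (suc n) x≈y = ∙-cong x≈y (pow-cong n x≈y)

  pow-≡ : ∀ x {i j} → i ≡ j → pow x i ≈ pow x j
  pow-≡ x i≡j = reflexive (≡.cong (pow x) i≡j)

  pow-+ : ∀ x i j → pow x (suc (i + j)) ≈ pow x i ∙ pow x j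
  pow-+ x zero    j = refl
  pow-+ x (suc i) j = trans (∙-congˡ (pow-+ x i j)) (sym (assoc x (pow x i) (pow x j)))

  pow-snoc : ∀ x n → pow x (suc n) ≈ pow x n ∙ x
  pow-snoc x n = trans (pow-≡ x (≡.cong suc (≡.sym (ℕ.+-identityʳ n)))) (pow-+ x n zero)

  pow-absorbʳ : ∀ {A y} → A ∙ y ≈ A → ∀ n → pow A n ∙ y ≈ pow A n
  pow-absorbʳ Ay≈A zero    = Ay≈A
  pow-absorbʳ Ay≈A (suc n) = trans (assoc _ _ _) (∙-congˡ (pow-absorbʳ Ay≈A n))

  pow∈J : ∀ x n → J x (pow x n)
  pow∈J x zero    = J-refl x
  pow∈J x (suc n) = J-trans (pow∈J x n) (J-left x (pow x n))

  Periodic : Set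
  Periodic = ∀ x → ∃₂ λ m d → pow x m ≈ pow x (suc (d + m))

  -- the power xⁱ⁺¹ with i + 1 = (m + 1)(d + 1) is idempotent
  idempotent-power : Periodic → ∀ x → ∃ λ i → IsIdempotent S (pow x i)
  idempotent-power periodic x with periodic x
  ... | m , d , xᵐ≈xᵐ⁺ᵖ = i , idem
    where
      period : ℕ
      period = suc d

      shift : ∀ j → pow x (j + m) ≈ pow x (period + (j + m))
      shift zero    = xᵐ≈xᵐ⁺ᵖ
      shift (suc j) = trans (∙-congˡ (shift j))
                            (pow-≡ x (≡.cong suc (≡.sym (ℕ.+-suc d (j + m)))))

      shift* : ∀ t j → pow x (j + m) ≈ pow x (t * period + (j + m))
      shift* zero    j = refl
      shift* (suc t) j = begin
        pow x (j + m)                            ≈⟨ shift* t j ⟩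
        pow x (t * period + (j + m))             ≈⟨ pow-≡ x (≡.sym (ℕ.+-assoc (t * period) j m)) ⟩
        pow x ((t * period + j) + m)             ≈⟨ shift (t * period + j) ⟩
        pow x (period + ((t * period + j) + m))  ≈⟨ pow-≡ x (regroup d t j m) ⟩
        pow x (suc t * period + (j + m))         ∎
        where
          regroup : ∀ d t j m → suc d + ((t * suc d + j) + m) ≡ suc t * suc d + (j + m)
          regroup = solve-∀

      j₀ i : ℕ
      j₀ = d + m * d
      i  = j₀ + m

      double : suc (i + i) ≡ suc m * period + (j₀ + m)
      double = twice d m
        where
          twice : ∀ d m → suc ((d + m * d + m) + (d + m * d + m)) ≡ suc m * suc d + (d + m * d + m)
          twice = solve-∀

      idem : pow x i ∙ pow x i ≈ pow x i
      idem = begin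
        pow x i ∙ pow x i                  ≈⟨ pow-+ x i i ⟨
        pow x (suc (i + i))                ≈⟨ pow-≡ x double ⟩
        pow x (suc m * period + (j₀ + m))  ≈⟨ shift* (suc m) j₀ ⟨
        pow x i                            ∎

  -- If AB = e and Ae = A, then e is a power of A: e = Aⁿ⁺¹Bⁿ⁺¹ for all n,
  -- and a period of A can be pulled out of Aᵐ⁺¹.
  right-identity-is-power : Periodic → ∀ {A B e} → A ∙ B ≈ e → A ∙ e ≈ A →
                            ∃ λ d → e ≈ pow A d
  right-identity-is-power periodic {A} {B} {e} AB≈e Ae≈A with periodic A
  ... | m , d , Aᵐ≈Aᵐ⁺ᵈ⁺¹ = d , (begin
    e                               ≈⟨ e≈AⁿBⁿ m ⟨
    pow A m ∙ pow B m               ≈⟨ ∙-congʳ Aᵐ≈Aᵐ⁺ᵈ⁺¹ ⟩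
    pow A (suc (d + m)) ∙ pow B m   ≈⟨ ∙-congʳ (pow-+ A d m) ⟩
    (pow A d ∙ pow A m) ∙ pow B m   ≈⟨ assoc _ _ _ ⟩
    pow A d ∙ (pow A m ∙ pow B m)   ≈⟨ ∙-congˡ (e≈AⁿBⁿ m) ⟩
    pow A d ∙ e                     ≈⟨ pow-absorbʳ Ae≈A d ⟩
    pow A d                         ∎)
    where
      e≈AⁿBⁿ : ∀ n → pow A n ∙ pow B n ≈ e
      e≈AⁿBⁿ zero    = AB≈e
      e≈AⁿBⁿ (suc n) = begin
        (A ∙ pow A n) ∙ (B ∙ pow B n)  ≈⟨ ∙-congʳ (pow-snoc A n) ⟩
        (pow A n ∙ A) ∙ (B ∙ pow B n)  ≈⟨ assoc _ _ _ ⟩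
        pow A n ∙ (A ∙ (B ∙ pow B n))  ≈⟨ ∙-congˡ (assoc _ _ _) ⟨
        pow A n ∙ ((A ∙ B) ∙ pow B n)  ≈⟨ ∙-congˡ (∙-congʳ AB≈e) ⟩
        pow A n ∙ (e ∙ pow B n)        ≈⟨ assoc _ _ _ ⟨
        (pow A n ∙ e) ∙ pow B n        ≈⟨ ∙-congʳ (pow-absorbʳ Ae≈A n) ⟩
        pow A n ∙ pow B n              ≈⟨ e≈AⁿBⁿ n ⟩
        e                              ∎

-- Writing e = sft, the elements A = e(sf) and B = (ft)e satisfy AB = e and
-- Ae = Af = A; so e is a power of A and ef = e, whence f = ef = e.
module Idempotents (S : Semigroup 0ℓ 0ℓ) where
  open Semigroup S
  open Principal S using (J; _·ˡ_; _·ʳ_)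
  open Powers S
  open import Relation.Binary.Reasoning.Setoid setoid

  module _ {f : Carrier} (ff≈f : f ∙ f ≈ f) where
    idem-right : ∀ s → (s ·ˡ f) ∙ f ≈ s ·ˡ f
    idem-right nothing  = ff≈f
    idem-right (just s) = trans (assoc s f f) (∙-congˡ ff≈f)

    idem-middle : ∀ s t → (s ·ˡ f) ∙ (f ·ʳ t) ≈ (s ·ˡ f) ·ʳ t
    idem-middle s nothing  = idem-right s
    idem-middle s (just t) = trans (sym (assoc _ f t)) (∙-congʳ (idem-right s))

  comparable-J-idempotents : Periodic → ∀ {e f} →
    IsIdempotent S e → IsIdempotent S f → _≤E_ S f e → J f e → f ≈ e
  comparable-J-idempotents periodic {e} {f} ee≈e ff≈f (f≈ef , f≈fe) (s , t , e≈sft) = begin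
    f            ≈⟨ f≈ef ⟩
    e ∙ f        ≈⟨ ∙-congʳ e≈Aᵈ ⟩
    pow A d ∙ f  ≈⟨ pow-absorbʳ Af≈A d ⟩
    pow A d      ≈⟨ e≈Aᵈ ⟨
    e            ∎
    where
      A B : Carrier
      A = e ∙ (s ·ˡ f)
      B = (f ·ʳ t) ∙ e

      AB≈e : A ∙ B ≈ e
      AB≈e = begin
        (e ∙ (s ·ˡ f)) ∙ ((f ·ʳ t) ∙ e)  ≈⟨ assoc _ _ _ ⟩
        e ∙ ((s ·ˡ f) ∙ ((f ·ʳ t) ∙ e))  ≈⟨ ∙-congˡ (assoc _ _ _) ⟨
        e ∙ (((s ·ˡ f) ∙ (f ·ʳ t)) ∙ e)  ≈⟨ ∙-congˡ (∙-congʳ (idem-middle ff≈f s t)) ⟩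
        e ∙ (((s ·ˡ f) ·ʳ t) ∙ e)        ≈⟨ ∙-congˡ (∙-congʳ e≈sft) ⟨
        e ∙ (e ∙ e)                      ≈⟨ ∙-congˡ ee≈e ⟩
        e ∙ e                            ≈⟨ ee≈e ⟩
        e                                ∎

      Af≈A : A ∙ f ≈ A
      Af≈A = trans (assoc _ _ _) (∙-congˡ (idem-right ff≈f s))

      Ae≈A : A ∙ e ≈ A
      Ae≈A = begin
        A ∙ e        ≈⟨ ∙-congʳ Af≈A ⟨
        (A ∙ f) ∙ e  ≈⟨ assoc _ _ _ ⟩
        A ∙ (f ∙ e)  ≈⟨ ∙-congˡ f≈fe ⟨
        A ∙ f        ≈⟨ Af≈A ⟩
        A            ∎

      d : ℕ
      d = proj₁ (right-identity-is-power periodic AB≈e Ae≈A)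

      e≈Aᵈ : e ≈ pow A d
      e≈Aᵈ = proj₂ (right-identity-is-power periodic AB≈e Ae≈A)

module Automorphisms (S : Semigroup 0ℓ 0ℓ) where
  open Semigroup S
  open Principal S
  open Powers S using (pow)
  open Automorphism {S = S}

  Aut : Set
  Aut = Automorphism S

  inverse : Aut → Aut
  inverse h = record
    { fun        = h⁻¹
    ; cong       = λ {x} {y} x≈y → injective h (trans (h∘h⁻¹ x) (trans x≈y (sym (h∘h⁻¹ y))))
    ; homo       = λ x y → injective h (trans (h∘h⁻¹ (x ∙ y))
                     (trans (∙-cong (sym (h∘h⁻¹ x)) (sym (h∘h⁻¹ y))) (sym (homo h _ _))))
    ; injective  = λ {x} {y} p → trans (sym (h∘h⁻¹ x)) (trans (cong h p) (h∘h⁻¹ y))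
    ; surjective = λ y → fun h y , injective h (h∘h⁻¹ (fun h y))
    }
    where
      h⁻¹ : Carrier → Carrier
      h⁻¹ y = proj₁ (surjective h y)

      h∘h⁻¹ : ∀ y → fun h (h⁻¹ y) ≈ y
      h∘h⁻¹ y = proj₂ (surjective h y)

  inverseʳ : ∀ h y → fun h (fun (inverse h) y) ≈ y
  inverseʳ h y = proj₂ (surjective h y)

  inverseˡ : ∀ h x → fun (inverse h) (fun h x) ≈ x
  inverseˡ h x = injective h (inverseʳ h (fun h x))

  _∘ᴬ_ : Aut → Aut → Aut
  g ∘ᴬ h = record
    { fun        = λ x → fun g (fun h x)
    ; cong       = λ p → cong g (cong h p)
    ; homo       = λ x y → trans (cong g (homo h x y)) (homo g _ _)
    ; injective  = λ p → injective h (injective g p)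
    ; surjective = λ y → fun (inverse h) (fun (inverse g) y) ,
                         trans (cong g (inverseʳ h _)) (inverseʳ g y)
    }

  orbit-trans : ∀ {n} {r u v : Fin n → Carrier} →
                SameOrbit S r u → SameOrbit S r v → SameOrbit S u v
  orbit-trans {u = u} (g , gr≈u) (h , hr≈v) =
    h ∘ᴬ inverse g ,
    λ i → trans (cong h (injective g (trans (inverseʳ g (u i)) (sym (gr≈u i))))) (hr≈v i)

  fun-pow : ∀ h x n → fun h (pow x n) ≈ pow (fun h x) n
  fun-pow h x zero    = refl
  fun-pow h x (suc n) = trans (homo h _ _) (∙-congˡ (fun-pow h x n))

  fun¹ : Aut → Maybe Carrier → Maybe Carrier
  fun¹ h nothing  = nothing
  fun¹ h (just s) = just (fun h s)

  fun-sandwich : ∀ h s b t → fun h ((s ·ˡ b) ·ʳ t) ≈ (fun¹ h s ·ˡ fun h b) ·ʳ fun¹ h t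
  fun-sandwich h nothing  b nothing  = refl
  fun-sandwich h nothing  b (just t) = homo h _ _
  fun-sandwich h (just s) b nothing  = homo h _ _
  fun-sandwich h (just s) b (just t) = trans (homo h _ _) (∙-congʳ (homo h _ _))

  J-preserved : ∀ h {b x} → J b x → J (fun h b) (fun h x)
  J-preserved h {b} (s , t , x≈sbt) =
    fun¹ h s , fun¹ h t , trans (cong h x≈sbt) (fun-sandwich h s b t)

  J-reflected : ∀ h {b x} → J (fun h b) (fun h x) → J b x
  J-reflected h {b} {x} hx∈J =
    J-resp-base x (inverseˡ h b) (J-resp _ (inverseˡ h x) (J-preserved (inverse h) hx∈J))

  I-preserved : ∀ h {b x} → I b x → I (fun h b) (fun h x)
  I-preserved h (x∈J , ¬b∈Jx) = J-preserved h x∈J , λ hb∈J → ¬b∈Jx (J-reflected h hb∈J)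

  I-reflected : ∀ h {b x} → I (fun h b) (fun h x) → I b x
  I-reflected h (hx∈J , ¬hb∈J) = J-reflected h hx∈J , λ b∈J → ¬hb∈J (J-preserved h b∈J)

-- Finitely many orbits on pairs force periodicity: two of the pairs
-- (x, xᵏ⁺¹) share an orbit, and an automorphism fixing x and sending xⁱ⁺¹
-- to xʲ⁺¹ shows that these two powers are equal.
module Periodicity (S : Semigroup 0ℓ 0ℓ) where
  open Semigroup S
  open Powers S
  open Automorphisms S
  open Automorphism {S = S}
  open import Relation.Binary.Reasoning.Setoid setoid

  orbits-repeat : ∀ {n} → FinitelyManyOrbits S n → (u : ℕ → Fin n → Carrier) →
                  ∃₂ λ i j → i < j × SameOrbit S (u i) (u j)
  orbits-repeat (reps , cover) u
    with FinP.pigeonhole (ℕ.n<1+n (length reps)) (λ k → index (cover (u (toℕ k))))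
  ... | i , j , i<j , same-rep =
    toℕ i , toℕ j , i<j ,
    orbit-trans (≡.subst (λ k → SameOrbit S (lookup reps k) (u (toℕ i))) same-rep
                         (Any.lookup-index (cover (u (toℕ i)))))
                (Any.lookup-index (cover (u (toℕ j))))

  pair : Carrier → Carrier → Fin 2 → Carrier
  pair x y Fin.zero    = x
  pair x y (Fin.suc _) = y

  periodic : FinitelyManyOrbits S 2 → Periodic
  periodic orbits x with orbits-repeat orbits (λ k → pair x (pow x k))
  ... | i , j , i<j , h , h-maps = i , j ∸ suc i , (begin
    pow x i                      ≈⟨ pow-cong i (h-maps Fin.zero) ⟨
    pow (fun h x) i              ≈⟨ fun-pow h x i ⟨
    fun h (pow x i)              ≈⟨ h-maps (Fin.suc Fin.zero) ⟩
    pow x j                      ≈⟨ pow-≡ x j≡ ⟩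
    pow x (suc (j ∸ suc i + i))  ∎)
    where
      j≡ : j ≡ suc (j ∸ suc i + i)
      j≡ = ≡.trans (≡.sym (ℕ.m∸n+n≡m i<j)) (ℕ.+-suc (j ∸ suc i) i)

-- Transfer of finitely many orbits along an encoding of tuples: if n-tuples
-- of T are encoded as m-tuples of S so that encodings in a common S-orbit
-- come from tuples in a common T-orbit, then finitely many S-orbits on
-- m-tuples give finitely many T-orbits on n-tuples (one representative for
-- each S-orbit meeting the image of the encoding).
module OrbitTransfer (em : ExcludedMiddle (lsuc 0ℓ)) where
  open Classical em

  orbits-transfer : (S T : Semigroup 0ℓ 0ℓ) {n m : ℕ} →
    let open Semigroup in
    (encode : (Fin n → Carrier T) → (Fin m → Carrier S)) →
    (∀ u v → SameOrbit S (encode u) (encode v) → SameOrbit T u v) →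
    FinitelyManyOrbits S m → FinitelyManyOrbits T n
  orbits-transfer S T {n} {m} encode reflect (reps , cover) =
    mapMaybe decode reps , λ u → mapMaybe-cover decode (decode-correct u) (cover (encode u))
    where
      open Semigroup using (Carrier)

      Meets : (Fin m → Carrier S) → Set
      Meets r = ∃ λ v → SameOrbit S r (encode v)

      decodeFrom : ∀ r → Dec (Meets r) → Maybe (Fin n → Carrier T)
      decodeFrom r (yes (v , _)) = just v
      decodeFrom r (no _)        = nothing

      decode : (Fin m → Carrier S) → Maybe (Fin n → Carrier T)
      decode r = decodeFrom r (decide (Meets r))

      decodeFrom-correct : ∀ u {r} (d : Dec (Meets r)) → SameOrbit S r (encode u) →
                           MaybeAny.Any (λ v → SameOrbit T v u) (decodeFrom r d)
      decodeFrom-correct u (yes (v , r~v)) r~u =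
        MaybeAny.just (reflect v u (Automorphisms.orbit-trans S r~v r~u))
      decodeFrom-correct u (no ¬meets) r~u = ⊥-elim (¬meets (u , r~u))

      decode-correct : ∀ u {r} → SameOrbit S r (encode u) →
                       MaybeAny.Any (λ v → SameOrbit T v u) (decode r)
      decode-correct u {r} = decodeFrom-correct u (decide (Meets r))

-- If some product xy is nonzero then a = LaR with L, R ∈ J(a)
-- (`self-divisible`); an idempotent power e of R is nonzero since a = Xae,
-- and primitive by `comparable-J-idempotents`; every element of J(a) factors
-- through every nonzero element (`factor-through`), so the only ideals are
-- {0} and the whole factor.
module ReesFactor (em : ExcludedMiddle (lsuc 0ℓ)) (S : Semigroup 0ℓ 0ℓ)
                  (periodic : Powers.Periodic S) (a x₀ : Semigroup.Carrier S)
                  (x₀∈I : Principal.I S a x₀) where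
  open Classical em
  open Semigroup S
  open Principal S
  open Rees a
  open Powers S
  open Idempotents S
  open Factorisation S
  open import Relation.Binary.Reasoning.Setoid setoid

  T : Semigroup 0ℓ 0ℓ
  T = semigroup

  zeroᴿ : Car
  zeroᴿ = x₀ , proj₁ x₀∈I

  zeroᴿ-isZero : IsZero T zeroᴿ
  zeroᴿ-isZero (x , _) = inj₂ (I-right a x₀ x x₀∈I , x₀∈I) , inj₂ (I-left a x x₀ x₀∈I , x₀∈I)

  _≈ᴿ_ : Carrier → Carrier → Set
  x ≈ᴿ y = x ≈ y ⊎ (I a x × I a y)

  nonzero⇒∉I : ∀ {x} → ¬ x ≈ᴿ x₀ → ¬ I a x
  nonzero⇒∉I x≉0 x∈I = x≉0 (inj₂ (x∈I , x₀∈I))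

  ∉I⇒nonzero : ∀ {x} → ¬ I a x → ¬ x ≈ᴿ x₀
  ∉I⇒nonzero x∉I (inj₁ x≈x₀)      = x∉I (I-resp a (sym x≈x₀) x₀∈I)
  ∉I⇒nonzero x∉I (inj₂ (x∈I , _)) = x∉I x∈I

  ≈ᴿ⇒≈ˡ : ∀ {x y} → ¬ I a x → x ≈ᴿ y → x ≈ y
  ≈ᴿ⇒≈ˡ x∉I (inj₁ x≈y)       = x≈y
  ≈ᴿ⇒≈ˡ x∉I (inj₂ (x∈I , _)) = ⊥-elim (x∉I x∈I)

  ≈ᴿ⇒≈ʳ : ∀ {x y} → ¬ I a y → x ≈ᴿ y → x ≈ y
  ≈ᴿ⇒≈ʳ y∉I (inj₁ x≈y)       = x≈y
  ≈ᴿ⇒≈ʳ y∉I (inj₂ (_ , y∈I)) = ⊥-elim (y∉I y∈I)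

  ∉I⇒J : ∀ {x} → J a x → ¬ I a x → J x a
  ∉I⇒J x∈J x∉I = stable (λ ¬a∈Jx → x∉I (x∈J , ¬a∈Jx))

  -- The non-null case, where a = LaR with L, R ∈ J(a).
  module SelfDivisible {L R : Carrier} (L∈J : J a L) (R∈J : J a R)
                       (a≈LaR : a ≈ (L ∙ a) ∙ R) where

    a≈XaRⁿ : ∀ n → ∃ λ X → a ≈ (X ∙ a) ∙ pow R n
    a≈XaRⁿ zero    = L , a≈LaR
    a≈XaRⁿ (suc n) with a≈XaRⁿ n
    ... | X , a≈XaRⁿ⁺¹ = X ∙ L , (begin
      a                                ≈⟨ a≈XaRⁿ⁺¹ ⟩
      (X ∙ a) ∙ pow R n                ≈⟨ ∙-congʳ (∙-congˡ a≈LaR) ⟩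
      (X ∙ ((L ∙ a) ∙ R)) ∙ pow R n    ≈⟨ ∙-congʳ (assoc X (L ∙ a) R) ⟨
      ((X ∙ (L ∙ a)) ∙ R) ∙ pow R n    ≈⟨ assoc (X ∙ (L ∙ a)) R (pow R n) ⟩
      (X ∙ (L ∙ a)) ∙ (R ∙ pow R n)    ≈⟨ ∙-congʳ (assoc X L a) ⟨
      ((X ∙ L) ∙ a) ∙ pow R (suc n)    ∎)

    i : ℕ
    i = proj₁ (idempotent-power periodic R)

    -- the idempotent power e = Rⁱ⁺¹ lies in J(a) ∖ I(a), since a = Xae
    e : Carrier
    e = pow R i

    ee≈e : e ∙ e ≈ e
    ee≈e = proj₂ (idempotent-power periodic R)

    e∈J : J a e
    e∈J = J-trans R∈J (pow∈J R i)

    e∉I : ¬ I a e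
    e∉I (_ , ¬a∈Je) with a≈XaRⁿ i
    ... | X , a≈Xae = ¬a∈Je (J-resp e (sym a≈Xae) (J-left (X ∙ a) e))

    eᴿ : Car
    eᴿ = e , e∈J

    eᴿ-primitive : IsPrimitive₀ T zeroᴿ eᴿ
    eᴿ-primitive = inj₁ ee≈e , ∉I⇒nonzero e∉I , minimal
      where
        minimal : ∀ f → IsIdempotent T f → ¬ f ≈R zeroᴿ → _≤E_ T f eᴿ → f ≈R eᴿ
        minimal (f , f∈J) ff≈f f≉0 (f≈ef , f≈fe) =
          inj₁ (comparable-J-idempotents periodic ee≈e (≈ᴿ⇒≈ʳ f∉I ff≈f)
                  (≈ᴿ⇒≈ˡ f∉I f≈ef , ≈ᴿ⇒≈ˡ f∉I f≈fe) (J-trans (∉I⇒J f∈J f∉I) e∈J))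
          where
            f∉I : ¬ I a f
            f∉I = nonzero⇒∉I f≉0

    nonzero-generates : ∀ Q → IsIdeal T Q → ∀ b → Q b → ¬ I a (proj₁ b) → ∀ c → Q c
    nonzero-generates Q Q-ideal (b , b∈J) Qb b∉I (c , c∈J)
      with factor-through a≈LaR (∉I⇒J b∈J b∉I) c∈J
    ... | X , Y , X∈JL , Y∈JR , c≈XbY =
      resp (inj₁ (sym c≈XbY))
           (closedʳ _ (Y , J-trans R∈J Y∈JR) (closedˡ (X , J-trans L∈J X∈JL) (b , b∈J) Qb))
      where open IdealLaws T Q-ideal

    ideals : ∀ Q → IsIdeal T Q → (∀ x → Q x → x ≈R zeroᴿ) ⊎ (∀ x → Q x)
    ideals Q Q-ideal with decide (∃ λ b → Q b × ¬ I a (proj₁ b))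
    ... | yes (b , Qb , b∉I) = inj₂ (nonzero-generates Q Q-ideal b Qb b∉I)
    ... | no  ¬nonzero       =
      inj₁ λ x Qx → inj₂ (stable (λ x∉I → ¬nonzero (x , Qx , x∉I)) , x₀∈I)

  classify : IsCompletely0Simple T ⊎ IsCompletelySimple T ⊎ IsNull T
  classify with decide (∃₂ λ x y → ¬ (x ∙R y) ≈R zeroᴿ)
  ... | no all-zero =
    inj₂ (inj₂ (zeroᴿ , zeroᴿ-isZero , λ x y → stable (λ xy≉0 → all-zero (x , y , xy≉0))))
  ... | yes ((x , x∈J) , (y , y∈J) , xy≉0)
    with self-divisible x∈J y∈J (∉I⇒J (J-trans x∈J (J-right x y)) (nonzero⇒∉I xy≉0))
  ...   | L , R , L∈Jx , R∈Jy , a≈LaR =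
    inj₁ (zeroᴿ , (zeroᴿ-isZero , ((x , x∈J) , (y , y∈J) , xy≉0) , ideals) , eᴿ , eᴿ-primitive)
    where open SelfDivisible (J-trans x∈J L∈Jx) (J-trans y∈J R∈Jy) a≈LaR

-- It is simple,
-- because an ideal Q of K generates the ideal KQK of S, which contains K by
-- minimality; and an idempotent power g of an element of K is primitive,
-- because K ⊆ J(f) for every f, so `comparable-J-idempotents` applies.
module KernelFactor (S : Semigroup 0ℓ 0ℓ) (periodic : Powers.Periodic S)
                    (K : Semigroup.Carrier S → Set) (K-kernel : IsKernel S K) where
  open Semigroup S
  open Principal S
  open Powers S
  open Idempotents S

  K-ideal : IsIdeal S K
  K-ideal = proj₁ K-kernel

  module K = IdealLaws S K-ideal

  K-minimal : ∀ Q → IsIdeal S Q → ∀ x → K x → Q x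
  K-minimal = proj₂ K-kernel

  T : Semigroup 0ℓ 0ℓ
  T = Sub.semigroup K K-ideal

  Elem : Set
  Elem = Σ Carrier K

  KQK : (Elem → Set) → Carrier → Set
  KQK Q x = ∃ λ (k₁ : Elem) → ∃ λ (q : Elem) → Q q × ∃ λ (k₂ : Elem) →
              x ≈ (proj₁ k₁ ∙ proj₁ q) ∙ proj₁ k₂

  KQK-ideal : ∀ {Q} → ∃ Q → IsIdeal S (KQK Q)
  KQK-ideal ((q , q∈K) , Qq) =
    (λ x≈y (k₁ , q , Qq , k₂ , x≈kqk) → k₁ , q , Qq , k₂ , trans (sym x≈y) x≈kqk)
    , ((q ∙ q) ∙ q , (q , q∈K) , (q , q∈K) , Qq , (q , q∈K) , refl)
    , (λ s x (k₁ , q , Qq , k₂ , x≈kqk) →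
         (s ∙ proj₁ k₁ , K.closedˡ s _ (proj₂ k₁)) , q , Qq , k₂ ,
         trans (∙-congˡ x≈kqk) (trans (sym (assoc _ _ _)) (∙-congʳ (sym (assoc _ _ _)))))
    , (λ x s (k₁ , q , Qq , k₂ , x≈kqk) →
         k₁ , q , Qq , (proj₁ k₂ ∙ s , K.closedʳ _ s (proj₂ k₂)) ,
         trans (∙-congʳ x≈kqk) (assoc _ _ _))

  simple : IsSimple T
  simple Q Q-ideal (w , w∈K) = KQK⊆Q w∈K (K-minimal (KQK Q) (KQK-ideal inhabited) w w∈K)
    where
      open IdealLaws T Q-ideal

      KQK⊆Q : ∀ {x} (x∈K : K x) → KQK Q x → Q (x , x∈K)
      KQK⊆Q x∈K (k₁ , q , Qq , k₂ , x≈kqk) = resp (sym x≈kqk) (closedʳ _ k₂ (closedˡ k₁ q Qq))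

  k₀ : Elem
  k₀ = K.inhabited

  pow∈K : ∀ n → K (pow (proj₁ k₀) n)
  pow∈K zero    = proj₂ k₀
  pow∈K (suc n) = K.closedˡ (proj₁ k₀) _ (pow∈K n)

  i : ℕ
  i = proj₁ (idempotent-power periodic (proj₁ k₀))

  g : Elem
  g = pow (proj₁ k₀) i , pow∈K i

  gg≈g : IsIdempotent S (proj₁ g)
  gg≈g = proj₂ (idempotent-power periodic (proj₁ k₀))

  J-ideal : ∀ f → IsIdeal S (J f)
  J-ideal f = J-resp f , (f , J-refl f) , (λ s x x∈J → J-trans x∈J (J-left s x))
            , (λ x s x∈J → J-trans x∈J (J-right x s))

  g-primitive : IsPrimitive T g
  g-primitive = gg≈g , λ (f , _) ff≈f f≤g →
    comparable-J-idempotents periodic gg≈g ff≈f f≤g (K-minimal (J f) (J-ideal f) _ (proj₂ g))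

  completely-simple : IsCompletelySimple T
  completely-simple = simple , g , g-primitive

module FactorSymmetries (S : Semigroup 0ℓ 0ℓ) where
  open Semigroup S
  open Principal S
  open Automorphisms S
  open Automorphism {S = S}

  I-resp-base : ∀ {a b x} → a ≈ b → I a x → I b x
  I-resp-base {x = x} a≈b (x∈J , ¬a∈Jx) =
    J-resp-base x a≈b x∈J , λ b∈Jx → ¬a∈Jx (J-trans b∈Jx (nothing , nothing , a≈b))

  rees-iso : (h : Aut) → ∀ {a b} → fun h a ≈ b → Rees.semigroup a ≅ Rees.semigroup b
  rees-iso h {a} {b} ha≈b = record
    { fun        = λ (x , x∈J) → fun h x , J-resp-base _ ha≈b (J-preserved h x∈J)
    ; cong       = λ { (inj₁ x≈y)         → inj₁ (cong h x≈y)
                     ; (inj₂ (x∈I , y∈I)) → inj₂ (I-map x∈I , I-map y∈I) }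
    ; homo       = λ _ _ → inj₁ (homo h _ _)
    ; injective  = λ { (inj₁ hx≈hy)         → inj₁ (injective h hx≈hy)
                     ; (inj₂ (hx∈I , hy∈I)) → inj₂ (I-unmap hx∈I , I-unmap hy∈I) }
    ; surjective = λ (y , y∈J) →
        (fun (inverse h) y ,
         J-reflected h (J-resp _ (sym (inverseʳ h y)) (J-resp-base _ (sym ha≈b) y∈J))) ,
        inj₁ (inverseʳ h y)
    }
    where
      I-map : ∀ {x} → I a x → I b (fun h x)
      I-map x∈I = I-resp-base ha≈b (I-preserved h x∈I)

      I-unmap : ∀ {x} → I b (fun h x) → I a x
      I-unmap hx∈I = I-reflected h (I-resp-base (sym ha≈b) hx∈I)

  -- the kernel is invariant under automorphisms, since its preimage is an ideal
  kernel-invariant : ∀ {K} → IsKernel S K → ∀ h {x} → K x → K (fun h x)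
  kernel-invariant {K} (K-ideal , K-minimal) h {x} x∈K = K-minimal K∘h K∘h-ideal x x∈K
    where
      open IdealLaws S K-ideal

      K∘h : Carrier → Set
      K∘h y = K (fun h y)

      K∘h-ideal : IsIdeal S K∘h
      K∘h-ideal =
        (λ x≈y → resp (cong h x≈y))
        , (fun (inverse h) (proj₁ inhabited) , resp (sym (inverseʳ h _)) (proj₂ inhabited))
        , (λ s y hy∈K → resp (sym (homo h s y)) (closedˡ (fun h s) _ hy∈K))
        , (λ y s hy∈K → resp (sym (homo h y s)) (closedʳ _ (fun h s) hy∈K))

  restrict-to-kernel : ∀ {K} (ker : IsKernel S K) → Aut →
                       Automorphism (Sub.semigroup K (proj₁ ker))
  restrict-to-kernel ker h = record
    { fun        = λ (x , x∈K) → fun h x , kernel-invariant ker h x∈K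
    ; cong       = cong h
    ; homo       = λ _ _ → homo h _ _
    ; injective  = injective h
    ; surjective = λ (y , y∈K) →
        (fun (inverse h) y , kernel-invariant ker (inverse h) y∈K) , inverseʳ h y
    }

  -- any two kernels have the same elements, so their factors are isomorphic
  kernels-iso : ∀ {K K′} (ker : IsKernel S K) (ker′ : IsKernel S K′) →
                Sub.semigroup K (proj₁ ker) ≅ Sub.semigroup K′ (proj₁ ker′)
  kernels-iso {K} {K′} ker ker′ = record
    { fun        = λ (x , x∈K) → x , proj₂ ker K′ (proj₁ ker′) x x∈K
    ; cong       = λ x≈y → x≈y
    ; homo       = λ _ _ → refl
    ; injective  = λ x≈y → x≈y
    ; surjective = λ (y , y∈K′) → (y , proj₂ ker′ K (proj₁ ker) y y∈K′) , refl
    }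

≅⇒automorphism : ∀ {T} → T ≅ T → Automorphism T
≅⇒automorphism i = record
  { fun       = _≅_.fun i       ; cong       = _≅_.cong i ; homo = _≅_.homo i
  ; injective = _≅_.injective i ; surjective = _≅_.surjective i
  }

-- Every semigroup is `Countable`: the constant family P n = Carrier, with the
-- second projection, covers the carrier.
countable : ∀ T → Countable T
countable T = (λ _ → Semigroup.Carrier T) , proj₂ , λ y → (0 , y) , Semigroup.refl T

module PrincipalFactors (em : ExcludedMiddle (lsuc 0ℓ)) (S : Semigroup 0ℓ 0ℓ) where
  open Classical em
  open OrbitTransfer em
  open Semigroup S
  open Principal S
  open Automorphisms S
  open Automorphism {S = S}
  open FactorSymmetries S

  -- an n-tuple of J(a)/I(a) is encoded as the (n+1)-tuple (a, x₁, …, xₙ) of S;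
  -- an automorphism matching two encodings maps a to a, so it induces an
  -- automorphism of J(a)/I(a)
  rees-orbits : ∀ a n → FinitelyManyOrbits S (suc n) → FinitelyManyOrbits (Rees.semigroup a) n
  rees-orbits a n = orbits-transfer S (Rees.semigroup a) encode reflect
    where
      encode : (Fin n → Rees.Car a) → Fin (suc n) → Carrier
      encode u Fin.zero    = a
      encode u (Fin.suc i) = proj₁ (u i)

      reflect : ∀ u v → SameOrbit S (encode u) (encode v) → SameOrbit (Rees.semigroup a) u v
      reflect u v (h , h-maps) =
        ≅⇒automorphism (rees-iso h (h-maps Fin.zero)) , λ i → inj₁ (h-maps (Fin.suc i))

  kernel-orbits : ∀ {K} (ker : IsKernel S K) n → FinitelyManyOrbits S n →
                  FinitelyManyOrbits (Sub.semigroup K (proj₁ ker)) n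
  kernel-orbits ker n = orbits-transfer S (Sub.semigroup _ (proj₁ ker)) (λ u i → proj₁ (u i))
    (λ u v (h , h-maps) → restrict-to-kernel ker h , h-maps)

  factor-orbits : (∀ n → 1 ≤ n → FinitelyManyOrbits S n) →
                  ∀ p n → 1 ≤ n → FinitelyManyOrbits (principalFactor p) n
  factor-orbits orbits (inj₁ (a , _))   n _   = rees-orbits a n (orbits (suc n) (s≤s z≤n))
  factor-orbits orbits (inj₂ (K , ker)) n 1≤n = kernel-orbits ker n (orbits n 1≤n)

  -- The factors J(r)/I(r), for the orbit representatives r of single elements
  -- with I(r) ≠ ∅, together with the kernel if there is one, represent every
  -- principal factor: J(a)/I(a) ≅ J(r)/I(r) for the representative r of a.
  factor-representatives : FinitelyManyOrbits S 1 →
    ∃ λ (L : List PrincipalFactorIndex) → ∀ p → Any (λ q → principalFactor p ≅ principalFactor q) L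
  factor-representatives (reps , cover) =
    mapMaybe reesIndex reps ++ kernelIndices (decide₁ (Σ (Carrier → Set) (IsKernel S))) , covered
    where
      HasI : (Fin 1 → Carrier) → Set
      HasI r = ∃ λ x → I (r Fin.zero) x

      reesIndexFrom : ∀ r → Dec (HasI r) → Maybe PrincipalFactorIndex
      reesIndexFrom r (yes x∈I) = just (inj₁ (r Fin.zero , x∈I))
      reesIndexFrom r (no _)    = nothing

      reesIndex : (Fin 1 → Carrier) → Maybe PrincipalFactorIndex
      reesIndex r = reesIndexFrom r (decide (HasI r))

      kernelIndices : Dec (Σ (Carrier → Set) (IsKernel S)) → List PrincipalFactorIndex
      kernelIndices (yes ker) = inj₂ ker ∷ []
      kernelIndices (no _)    = []

      Represents : PrincipalFactorIndex → PrincipalFactorIndex → Set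
      Represents p q = principalFactor p ≅ principalFactor q

      -- if h(r) = a, then h⁻¹ maps I(a) into I(r), and h⁻¹(a) = r
      rees-represented : ∀ {a x₀} (x₀∈I : I a x₀) {r} (d : Dec (HasI r)) →
        SameOrbit S r (λ _ → a) → MaybeAny.Any (Represents (inj₁ (a , x₀ , x₀∈I))) (reesIndexFrom r d)
      rees-represented x₀∈I (yes _) (h , h-maps) =
        MaybeAny.just (rees-iso (inverse h) (trans (cong (inverse h) (sym (h-maps Fin.zero))) (inverseˡ h _)))
      rees-represented {a} {x₀} x₀∈I (no ¬HasI) (h , h-maps) =
        ⊥-elim (¬HasI (_ , I-reflected h (I-resp-base (sym (h-maps Fin.zero))
                                           (I-resp a (sym (inverseʳ h x₀)) x₀∈I))))

      kernel-represented : ∀ {K} (ker : IsKernel S K) d →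
                           Any (Represents (inj₂ (K , ker))) (kernelIndices d)
      kernel-represented ker (yes (K′ , ker′)) = Any.here (kernels-iso ker ker′)
      kernel-represented ker (no ¬kernel)      = ⊥-elim (¬kernel (_ , ker))

      covered : ∀ p → Any (Represents p) (mapMaybe reesIndex reps ++ kernelIndices _)
      covered (inj₁ (a , x₀ , x₀∈I)) =
        Any.++⁺ˡ (mapMaybe-cover reesIndex (λ {r} → rees-represented x₀∈I (decide (HasI r)))
                                 (cover (λ _ → a)))
      covered (inj₂ (K , ker)) = Any.++⁺ʳ (mapMaybe reesIndex reps) (kernel-represented ker _)

theorem4p1 : ExcludedMiddle (lsuc 0ℓ) → (S : Semigroup 0ℓ 0ℓ) → Aleph0Categorical S →
    ((p : Principal.PrincipalFactorIndex S) →
      Aleph0Categorical (Principal.principalFactor S p)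
      × (IsCompletely0Simple (Principal.principalFactor S p)
         ⊎ IsCompletelySimple (Principal.principalFactor S p)
         ⊎ IsNull (Principal.principalFactor S p)))
    × (∃ λ (L : List (Principal.PrincipalFactorIndex S)) →
         (p : Principal.PrincipalFactorIndex S) →
           Any (λ q → Principal.principalFactor S p ≅ Principal.principalFactor S q) L)
theorem4p1 em S (_ , orbits) =
  (λ p → (countable (principalFactor p) , factor-orbits orbits p) , classify p) ,
  factor-representatives (orbits 1 (s≤s z≤n))
  where
    open Principal S
    open PrincipalFactors em S

    periodic : Powers.Periodic S
    periodic = Periodicity.periodic S (orbits 2 (s≤s z≤n))

    classify : ∀ p → IsCompletely0Simple (principalFactor p)
                     ⊎ IsCompletelySimple (principalFactor p) ⊎ IsNull (principalFactor p)
    classify (inj₁ (a , x₀ , x₀∈I)) = ReesFactor.classify em S periodic a x₀ x₀∈I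
    classify (inj₂ (K , ker))        = inj₂ (inj₁ (KernelFactor.completely-simple S periodic K ker))
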